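{- Let $H$ be a 1-extendable graph and let $G$ be a graph with $G \supseteq H$, $V(G)=V(H)$ and $\Phi(G)=\Phi(H)$. Then every barrier of $G$ is a barrier of $H$.
   Context: All graphs are finite and simple. $\Phi(G)$ is the number of perfect matchings of $G$. An edge is extendable if it lies in some perfect matching. A connected graph is 1-extendable if every edge is extendable. For $S\subseteq V(G)$, $\operatorname{odd}(G-S)$ is the number of odd-order components of $G-S$; $S$ is a barrier of $G$ if $\operatorname{odd}(G-S)=|S|$ (the empty set counts as a barrier). -}

module Defs where

open import Data.Nat using (ℕ; zero; suc; _<ᵇ_)
open import Data.Nat.Properties using ()
open import Data.Bool using (Bool; true; false; _∧_; _∨_; not; T)
open import Data.Fin using (Fin; toℕ)
open import Data.Fin.Properties using () renaming (_≟_ to _≟ᶠ_)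
open import Data.Fin.Subset using (Subset; ∣_∣)
open import Data.Vec using (Vec; []; _∷_; lookup)
open import Data.List using (List; []; _∷_; map; concatMap; filter; length; allFin)
open import Data.Bool.ListAction using (all; any)
open import Data.Product using (Σ; _×_; _,_)
open import Relation.Binary.PropositionalEquality using (_≡_)
open import Relation.Nullary.Decidable using (⌊_⌋)
open import Data.Bool.Properties using (T?)

record Graph (n : ℕ) : Set where
  field
    adj    : Fin n → Fin n → Bool
    sym    : ∀ u v → adj u v ≡ adj v u
    irrefl : ∀ v → adj v v ≡ false
open Graph public

_==_ : {n : ℕ} → Fin n → Fin n → Bool
u == v = ⌊ u ≟ᶠ v ⌋

countV : {n : ℕ} → (Fin n → Bool) → ℕ
countV {n} p = length (filter (λ i → T? (p i)) (allFin n))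

_⊆ᴳ_ : {n : ℕ} → Graph n → Graph n → Set
H ⊆ᴳ G = ∀ u v → adj H u v ≡ true → adj G u v ≡ true

-- A perfect matching M of G is encoded by its partner map σ (σ v = the
-- vertex matched to v), stored as a vector: σ is a fixed-point-free
-- involution with v σ(v) ∈ E(G) for all v. This is a bijection between
-- perfect matchings and such vectors.

isPM : {n : ℕ} → Graph n → Vec (Fin n) n → Bool
isPM {n} G σ = all (λ v → (lookup σ (lookup σ v) == v)
                          ∧ not (lookup σ v == v)
                          ∧ adj G v (lookup σ v)) (allFin n)

allVecs : (n k : ℕ) → List (Vec (Fin n) k)
allVecs n zero = [] ∷ []
allVecs n (suc k) = concatMap (λ i → map (i ∷_) (allVecs n k)) (allFin n)

Φ : {n : ℕ} → Graph n → ℕ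
Φ {n} G = length (filter (λ σ → T? (isPM G σ)) (allVecs n n))

Extendable : {n : ℕ} → Graph n → Fin n → Fin n → Set
Extendable {n} G u v =
  Σ (Vec (Fin n) n) (λ σ → (isPM G σ ≡ true) × (lookup σ u ≡ v))

-- Connectivity in G - S.
-- reach G S k u w = true iff there is a walk from u to w of length ≤ k
-- all of whose vertices avoid S (u, w themselves are assumed outside S).

reach : {n : ℕ} → Graph n → Subset n → ℕ → Fin n → Fin n → Bool
reach G S zero    u w = u == w
reach {n} G S (suc k) u w =
  reach G S k u w ∨
  any (λ x → reach G S k u x ∧ not (lookup S x) ∧ adj G x w) (allFin n)

-- u and w (both outside S) lie in the same component of G - S
-- (walks of length ≤ n suffice on n vertices)
sameComp : {n : ℕ} → Graph n → Subset n → Fin n → Fin n → Bool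
sameComp {n} G S u w = not (lookup S u) ∧ not (lookup S w) ∧ reach G S n u w

compSize : {n : ℕ} → Graph n → Subset n → Fin n → ℕ
compSize G S v = countV (sameComp G S v)

isOdd : ℕ → Bool
isOdd zero = false
isOdd (suc k) = not (isOdd k)

isRep : {n : ℕ} → Graph n → Subset n → Fin n → Bool
isRep {n} G S v = not (lookup S v) ∧
  all (λ u → not ((toℕ u <ᵇ toℕ v) ∧ sameComp G S u v)) (allFin n)

-- odd(G - S): number of odd-order components of G - S
-- (each component counted once via its least-indexed vertex)
odd : {n : ℕ} → Graph n → Subset n → ℕ
odd G S = countV (λ v → isRep G S v ∧ isOdd (compSize G S v))

Barrier : {n : ℕ} → Graph n → Subset n → Set
Barrier G S = odd G S ≡ ∣ S ∣

Connected : {n : ℕ} → Graph n → Set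
Connected {n} G = ∀ u v → reach G (Data.Fin.Subset.⊥) n u v ≡ true

OneExtendable : {n : ℕ} → Graph n → Set
OneExtendable G = Connected G × (∀ u v → adj G u v ≡ true → Extendable G u v)

-- Let S be a barrier of G, i.e. odd(G − S) = |S|. Two inequalities sandwich odd(H − S):
--   * odd(G − S) ≤ odd(H − S): each component of G − S is a union of components of
--     H − S (H ⊆ G), so an odd component of G − S contains an odd component of H − S,
--     and distinct components of G − S contain distinct ones;
--   * odd(H − S) ≤ |S|: the easy half of Tutte's theorem, since a 1-extendable graph on
--     at least two vertices has a perfect matching (its edges are extendable, and it has
--     an edge because it is connected). On one vertex G has no barrier at all.
module Submission where

open import Defs hiding (sym)
open import Data.Nat using (ℕ; zero; suc; _+_; _≤_; _<_; _<ᵇ_; z≤n; s≤s)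
open import Data.Nat.Properties
open import Data.Bool using (Bool; true; false; _∧_; _∨_; not; T; _xor_)
open import Data.Bool.Properties using (T?; T-≡; not-distribˡ-xor; not-injective; ¬-not) renaming (_≟_ to _≟ᵇ_)
open import Data.Bool.ListAction using (all; any)
open import Data.Fin using (Fin; zero; suc; toℕ)
open import Data.Fin.Properties using (toℕ<n; toℕ-injective; all?; ¬∀⟶∃¬) renaming (_≟_ to _≟ᶠ_)
open import Data.Fin.Subset using (Subset; ∣_∣) renaming (⊥ to ∅)
open import Data.Vec using (Vec; []; _∷_; lookup)
open import Data.List using (List; []; _∷_; _++_; filter; length; tabulate; allFin)
open import Data.List.Properties using (length-++)
open import Data.List.Membership.Propositional using (_∈_; lose)
open import Data.List.Membership.Propositional.Properties
  using (∈-∃++; ∈-++⁻; ∈-++⁺ˡ; ∈-++⁺ʳ; ∈-filter⁺; ∈-filter⁻; ∈-allFin)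
import Data.List.Relation.Unary.All as All
open import Data.List.Relation.Unary.All.Properties using (all⁺; all⁻)
open import Data.List.Relation.Unary.All.Properties.Core using (¬All⇒Any¬)
open import Data.List.Relation.Unary.Any using (here; there; satisfied)
open import Data.List.Relation.Unary.Any.Properties using (any⁺; any⁻)
open import Data.List.Relation.Unary.AllPairs using (_∷_)
open import Data.List.Relation.Unary.Unique.Propositional using (Unique)
open import Data.List.Relation.Unary.Unique.Propositional.Properties using (allFin⁺; filter⁺)
open import Data.Product using (Σ; _×_; _,_; proj₁; proj₂)
open import Data.Sum using (_⊎_; inj₁; inj₂)
open import Data.Empty using (⊥; ⊥-elim)
open import Function using (_∘_; id)
open import Function.Bundles using (Equivalence)
open import Relation.Nullary using (¬_; Dec; yes; no; contradiction)
open import Relation.Binary using (tri<; tri≈; tri>)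
open import Relation.Binary.PropositionalEquality

∧-intro : ∀ {a b} → a ≡ true → b ≡ true → a ∧ b ≡ true
∧-intro refl refl = refl

∧-elimˡ : ∀ {a b} → a ∧ b ≡ true → a ≡ true
∧-elimˡ {true} _ = refl

∧-elimʳ : ∀ a {b} → a ∧ b ≡ true → b ≡ true
∧-elimʳ true e = e

∨-introˡ : ∀ {a b} → a ≡ true → a ∨ b ≡ true
∨-introˡ refl = refl

∨-introʳ : ∀ a {b} → b ≡ true → a ∨ b ≡ true
∨-introʳ true  _ = refl
∨-introʳ false e = e

∨-elim : ∀ a {b} → a ∨ b ≡ true → a ≡ true ⊎ b ≡ true
∨-elim true  _ = inj₁ refl
∨-elim false e = inj₂ e

not-intro : ∀ {a} → a ≡ false → not a ≡ true
not-intro refl = refl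

not-elim : ∀ {a} → not a ≡ true → a ≡ false
not-elim {false} _ = refl

true≢false : ∀ {a} → a ≡ true → a ≡ false → ⊥
true≢false refl ()

¬T⇒false : ∀ {a} → ¬ T a → a ≡ false
¬T⇒false {false} _ = refl
¬T⇒false {true}  n = ⊥-elim (n _)

newly-true : ∀ {a b} → (a ≡ true → b ≡ true) → a ≢ b → a ≡ false × b ≡ true
newly-true {false} {true}  _ _   = refl , refl
newly-true {false} {false} _ a≢b = contradiction refl a≢b
newly-true {true}  f       a≢b   = contradiction (sym (f refl)) a≢b

bool-ext : ∀ {a b} → (a ≡ true → b ≡ true) → (b ≡ true → a ≡ true) → a ≡ b
bool-ext {true}  {true}  _ _ = refl
bool-ext {true}  {false} f _ = sym (f refl)
bool-ext {false} {true}  _ g = g refl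
bool-ext {false} {false} _ _ = refl

==-sound : ∀ {n} {u v : Fin n} → u == v ≡ true → u ≡ v
==-sound {u = u} {v} e with u ≟ᶠ v
... | yes p = p

==-refl : ∀ {n} (v : Fin n) → v == v ≡ true
==-refl v with v ≟ᶠ v
... | yes _ = refl
... | no v≢v = contradiction refl v≢v

all-elim : ∀ {A : Set} (f : A → Bool) {x xs} → all f xs ≡ true → x ∈ xs → f x ≡ true
all-elim f {xs = xs} e x∈ =
  Equivalence.to T-≡ (All.lookup (all⁺ f xs (Equivalence.from T-≡ e)) x∈)

all-counterexample : ∀ {A : Set} (f : A → Bool) xs → all f xs ≡ false → Σ A (λ x → f x ≡ false)
all-counterexample f xs e
  with x , ¬fx ← satisfied (¬All⇒Any¬ (T? ∘ f) xs (λ a → subst T e (all⁻ f a)))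
  = x , ¬T⇒false ¬fx

any-intro : ∀ {A : Set} (f : A → Bool) {x xs} → x ∈ xs → f x ≡ true → any f xs ≡ true
any-intro f x∈ e = Equivalence.to T-≡ (any⁺ f (lose x∈ (Equivalence.from T-≡ e)))

any-elim : ∀ {A : Set} (f : A → Bool) xs → any f xs ≡ true → Σ A (λ x → f x ≡ true)
any-elim f xs e with x , fx ← satisfied (any⁻ f xs (Equivalence.from T-≡ e))
  = x , Equivalence.to T-≡ fx

isOdd-+ : ∀ a b → isOdd (a + b) ≡ isOdd a xor isOdd b
isOdd-+ zero    b = refl
isOdd-+ (suc a) b = trans (cong not (isOdd-+ a b)) (not-distribˡ-xor (isOdd a) (isOdd b))

odd⇒pos : ∀ {m} → isOdd m ≡ true → 1 ≤ m
odd⇒pos {suc m} _ = s≤s z≤n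

bit : Bool → ℕ
bit true  = 1
bit false = 0

count : ∀ {n} → (Fin n → Bool) → ℕ
count {zero}  P = 0
count {suc n} P = bit (P zero) + count (P ∘ suc)

-- It agrees with the list-based `countV` of Defs (recall allFin n = tabulate id).
countV≡count : ∀ {n} (P : Fin n → Bool) → countV P ≡ count P
countV≡count {n} P = filter-tabulate id
  where
  filter-tabulate : ∀ {k} (g : Fin k → Fin n) →
    length (filter (λ i → T? (P i)) (tabulate g)) ≡ count (P ∘ g)
  filter-tabulate {zero}  g = refl
  filter-tabulate {suc k} g with P (g zero)
  ... | true  = cong suc (filter-tabulate (g ∘ suc))
  ... | false = filter-tabulate (g ∘ suc)

∣∣≡count : ∀ {n} (S : Subset n) → ∣ S ∣ ≡ count (lookup S)
∣∣≡count []          = refl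
∣∣≡count (true ∷ S)  = cong suc (∣∣≡count S)
∣∣≡count (false ∷ S) = ∣∣≡count S

count-cong : ∀ {n} {P Q : Fin n → Bool} → (∀ i → P i ≡ Q i) → count P ≡ count Q
count-cong {zero}  _ = refl
count-cong {suc n} e = cong₂ _+_ (cong bit (e zero)) (count-cong (e ∘ suc))

count-≤ : ∀ {n} (P : Fin n → Bool) → count P ≤ n
count-≤ {zero}  P = z≤n
count-≤ {suc n} P with P zero
... | true  = s≤s (count-≤ (P ∘ suc))
... | false = m≤n⇒m≤1+n (count-≤ (P ∘ suc))

count-split : ∀ {n} (P Q : Fin n → Bool) →
  count P ≡ count (λ i → P i ∧ Q i) + count (λ i → P i ∧ not (Q i))
count-split {zero}  P Q = refl
count-split {suc n} P Q rewrite count-split (P ∘ suc) (Q ∘ suc) with P zero | Q zero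
... | true  | true  = refl
... | true  | false = sym (+-suc _ _)
... | false | true  = refl
... | false | false = refl

count-pos : ∀ {n} (P : Fin n → Bool) (v : Fin n) → P v ≡ true → 1 ≤ count P
count-pos P zero    e rewrite e = s≤s z≤n
count-pos P (suc v) e = ≤-trans (count-pos (P ∘ suc) v e) (m≤n+m _ (bit (P zero)))

count-witness : ∀ {n} (P : Fin n → Bool) → 1 ≤ count P → Σ (Fin n) (λ v → P v ≡ true)
count-witness {suc n} P pos with P zero in e
... | true  = zero , e
... | false with v , Pv ← count-witness (P ∘ suc) pos = suc v , Pv

count-single : ∀ {n} (a : Fin n) → count (λ y → y == a) ≡ 1
count-single {suc n} zero    = cong suc (count-false n)
  where
  count-false : ∀ m → count {m} (λ _ → false) ≡ 0
  count-false zero    = refl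
  count-false (suc m) = count-false m
count-single {suc n} (suc a) = trans (count-cong (λ i → ==-suc i a)) (count-single a)
  where
  ==-suc : ∀ (i a : Fin n) → (Fin.suc i == Fin.suc a) ≡ (i == a)
  ==-suc i a with i ≟ᶠ a
  ... | yes _ = refl
  ... | no _  = refl

count-strict : ∀ {n} (P Q : Fin n → Bool) → (∀ v → P v ≡ true → Q v ≡ true) →
  (w : Fin n) → Q w ≡ true → P w ≡ false → suc (count P) ≤ count Q
count-strict P Q P⊆Q w Qw ¬Pw = begin
  suc (count P)                                    ≡⟨ cong suc (count-cong (λ i → sym (Q∧P≡P i))) ⟩
  suc (count (λ i → Q i ∧ P i))                    ≡⟨ +-comm 1 _ ⟩
  count (λ i → Q i ∧ P i) + 1                      ≤⟨ +-monoʳ-≤ _ (count-pos _ w (∧-intro Qw (not-intro ¬Pw))) ⟩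
  count (λ i → Q i ∧ P i) + count (λ i → Q i ∧ not (P i)) ≡⟨ sym (count-split Q P) ⟩
  count Q                                          ∎
  where
  open ≤-Reasoning
  Q∧P≡P : ∀ i → Q i ∧ P i ≡ P i
  Q∧P≡P i = bool-ext (∧-elimʳ (Q i)) (λ Pi → ∧-intro (P⊆Q i Pi) Pi)

count-injection : ∀ {n} (P Q : Fin n → Bool) (Rel : Fin n → Fin n → Set) →
  (∀ v → P v ≡ true → Σ (Fin n) (λ w → Q w ≡ true × Rel v w)) →
  (∀ v v' w → P v ≡ true → P v' ≡ true → Rel v w → Rel v' w → v ≡ v') →
  count P ≤ count Q
count-injection {n} P Q Rel image unique = subst₂ _≤_ (countV≡count P) (countV≡count Q)
  (list-injection (filter⁺ (λ i → T? (P i)) (allFin⁺ n)) image′ unique′)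
  where
  members : (Fin n → Bool) → List (Fin n)
  members R = filter (λ i → T? (R i)) (allFin n)

  member⁻ : ∀ R {v} → v ∈ members R → R v ≡ true
  member⁻ R m = Equivalence.to T-≡ (proj₂ (∈-filter⁻ (λ i → T? (R i)) {xs = allFin n} m))

  image′ : ∀ {v} → v ∈ members P → Σ (Fin n) (λ w → w ∈ members Q × Rel v w)
  image′ {v} m with w , Qw , r ← image v (member⁻ P m)
    = w , ∈-filter⁺ (λ i → T? (Q i)) (∈-allFin w) (Equivalence.from T-≡ Qw) , r

  unique′ : ∀ {v v' w} → v ∈ members P → v' ∈ members P → Rel v w → Rel v' w → v ≡ v'
  unique′ m m' = unique _ _ _ (member⁻ P m) (member⁻ P m')

  list-injection : ∀ {xs ys : List (Fin n)} → Unique xs →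
    (∀ {x} → x ∈ xs → Σ (Fin n) (λ w → w ∈ ys × Rel x w)) →
    (∀ {x x' w} → x ∈ xs → x' ∈ xs → Rel x w → Rel x' w → x ≡ x') →
    length xs ≤ length ys
  list-injection {[]}     _          _   _   = z≤n
  list-injection {x ∷ xs} (x∉ ∷ uxs) img inj with w , w∈ , rxw ← img (here refl)
    with as , bs , refl ← ∈-∃++ w∈ = begin
      suc (length xs)                 ≤⟨ s≤s (list-injection uxs img′ (λ a b → inj (there a) (there b))) ⟩
      suc (length (as ++ bs))         ≡⟨ cong suc (length-++ as) ⟩
      suc (length as + length bs)     ≡⟨ sym (+-suc (length as) (length bs)) ⟩
      length as + length (w ∷ bs)     ≡⟨ sym (length-++ as) ⟩
      length (as ++ w ∷ bs)           ∎
    where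
    open ≤-Reasoning
    -- the images of xs avoid w, the image of x
    img′ : ∀ {x'} → x' ∈ xs → Σ (Fin n) (λ w' → w' ∈ as ++ bs × Rel x' w')
    img′ x'∈ with w' , w'∈ , r' ← img (there x'∈) with ∈-++⁻ as w'∈
    ... | inj₁ p          = w' , ∈-++⁺ˡ p , r'
    ... | inj₂ (here refl) = ⊥-elim (All.lookup x∉ x'∈ (inj (here refl) (there x'∈) rxw r'))
    ... | inj₂ (there p)  = w' , ∈-++⁺ʳ as p , r'

module OddClass {n : ℕ} (R : Fin n → Fin n → Bool)
  (R-sym : ∀ x y → R x y ≡ true → R y x ≡ true)
  (R-trans : ∀ x y z → R x y ≡ true → R y z ≡ true → R x z ≡ true) where

  classIn : (Fin n → Bool) → Fin n → Fin n → Bool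
  classIn C x y = C y ∧ R x y

  without : (Fin n → Bool) → Fin n → Fin n → Bool
  without C x y = C y ∧ not (R x y)

  without-split : ∀ C x → count C ≡ count (classIn C x) + count (without C x)
  without-split C x = count-split C (R x)

  without-smaller : ∀ C x → C x ≡ true → R x x ≡ true → suc (count (without C x)) ≤ count C
  without-smaller C x Cx Rxx = begin
    suc (count (without C x))                   ≤⟨ +-monoˡ-≤ _ (count-pos _ x (∧-intro Cx Rxx)) ⟩
    count (classIn C x) + count (without C x)   ≡⟨ sym (without-split C x) ⟩
    count C                                     ∎
    where open ≤-Reasoning

  without-odd : ∀ C x → isOdd (count C) ≡ true → isOdd (count (classIn C x)) ≡ false →
    isOdd (count (without C x)) ≡ true
  without-odd C x odd-C even-x = begin
    isOdd (count (without C x))                                     ≡⟨ cong (_xor isOdd (count (without C x))) (sym even-x) ⟩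
    isOdd (count (classIn C x)) xor isOdd (count (without C x))     ≡⟨ sym (isOdd-+ (count (classIn C x)) _) ⟩
    isOdd (count (classIn C x) + count (without C x))               ≡⟨ cong isOdd (sym (without-split C x)) ⟩
    isOdd (count C)                                                 ≡⟨ odd-C ⟩
    true                                                            ∎
    where open ≡-Reasoning

  without-class : ∀ C x y → without C x y ≡ true → ∀ z → classIn C y z ≡ classIn (without C x) y z
  without-class C x y y∈ z = bool-ext
    (λ e → ∧-intro (∧-intro (∧-elimˡ e) (not-intro (unrelated (∧-elimʳ (C z) e)))) (∧-elimʳ (C z) e))
    (λ e → ∧-intro (∧-elimˡ (∧-elimˡ e)) (∧-elimʳ (without C x z) e))
    where
    unrelated : R y z ≡ true → R x z ≡ false
    unrelated Ryz with R x z in Rxz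
    ... | false = refl
    ... | true  = ⊥-elim (true≢false (R-trans x z y Rxz (R-sym y z Ryz)) (not-elim (∧-elimʳ (C y) y∈)))

  -- by induction on a bound k for |C|: remove the class of some x ∈ C if it is even
  oddClass′ : ∀ k (C : Fin n → Bool) → (∀ x → C x ≡ true → R x x ≡ true) →
    count C ≤ k → isOdd (count C) ≡ true →
    Σ (Fin n) (λ x → C x ≡ true × isOdd (count (classIn C x)) ≡ true)
  oddClass′ k C refl-C bound odd-C with x , Cx ← count-witness C (odd⇒pos odd-C)
    with isOdd (count (classIn C x)) in odd-x | k
  ... | true  | _    = x , Cx , odd-x
  ... | false | suc k′
    with y , y∈ , odd-y ← oddClass′ k′ (without C x) (λ z z∈ → refl-C z (∧-elimˡ z∈))
           (≤-pred (≤-trans (without-smaller C x Cx (refl-C x Cx)) bound)) (without-odd C x odd-C odd-x)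
    = y , ∧-elimˡ y∈ , trans (cong isOdd (count-cong (without-class C x y y∈))) odd-y
  ... | false | zero = contradiction (≤-trans (odd⇒pos odd-C) bound) λ ()

  oddClass : (C : Fin n → Bool) → (∀ x → C x ≡ true → R x x ≡ true) → isOdd (count C) ≡ true →
    Σ (Fin n) (λ x → C x ≡ true × isOdd (count (classIn C x)) ≡ true)
  oddClass C refl-C = oddClass′ n C refl-C (count-≤ C)

-- Walks in K − S, as encoded by `reach K S k u w`: a walk of length at most k from u to w
-- all of whose vertices except the last lie outside S.
module Walks {n : ℕ} (K : Graph n) (S : Subset n) where

  reach-snoc : ∀ k {u x w} → reach K S k u x ≡ true → lookup S x ≡ false → adj K x w ≡ true →
    reach K S (suc k) u w ≡ true
  reach-snoc k {u} {x} {w} r Sx xw = ∨-introʳ (reach K S k u w)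
    (any-intro (λ y → reach K S k u y ∧ not (lookup S y) ∧ adj K y w) (∈-allFin x)
      (∧-intro r (∧-intro (not-intro Sx) xw)))

  reach-unsnoc : ∀ k {u w} → reach K S (suc k) u w ≡ true → reach K S k u w ≡ true ⊎
    Σ (Fin n) (λ x → reach K S k u x ≡ true × lookup S x ≡ false × adj K x w ≡ true)
  reach-unsnoc k {u} {w} r with ∨-elim (reach K S k u w) r
  ... | inj₁ short = inj₁ short
  ... | inj₂ long with x , e ← any-elim _ (allFin n) long
    = inj₂ (x , ∧-elimˡ e , not-elim (∧-elimˡ last) , ∧-elimʳ (not (lookup S x)) last)
    where
    last : not (lookup S x) ∧ adj K x w ≡ true
    last = ∧-elimʳ (reach K S k u x) e

  reach-last-edge : ∀ k {u w} → reach K S k u w ≡ true → u ≢ w → Σ (Fin n) (λ x → adj K x w ≡ true)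
  reach-last-edge zero    r u≢w = contradiction (==-sound r) u≢w
  reach-last-edge (suc k) r u≢w with reach-unsnoc k r
  ... | inj₁ short             = reach-last-edge k short u≢w
  ... | inj₂ (x , _ , _ , xw) = x , xw

  reach-weaken : ∀ {k m u w} → k ≤ m → reach K S k u w ≡ true → reach K S m u w ≡ true
  reach-weaken {m = zero} z≤n r = r
  reach-weaken {k} {suc m} k≤ r with m≤n⇒m<n∨m≡n k≤
  ... | inj₂ refl = r
  ... | inj₁ k<   = ∨-introˡ (reach-weaken (≤-pred k<) r)

  reach-++ : ∀ a b {u v w} → reach K S a u v ≡ true → lookup S v ≡ false → reach K S b v w ≡ true →
    reach K S (b + a) u w ≡ true
  reach-++ a zero    r Sv r′ rewrite ==-sound r′ = r
  reach-++ a (suc b) r Sv r′ with reach-unsnoc b r′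
  ... | inj₁ short              = ∨-introˡ (reach-++ a b r Sv short)
  ... | inj₂ (x , r″ , Sx , xw) = reach-snoc (b + a) (reach-++ a b r Sv r″) Sx xw

  -- reversal: the edge onto w, reversed, followed by the reversed walk
  reach-sym : ∀ k {u w} → lookup S u ≡ false → lookup S w ≡ false → reach K S k u w ≡ true →
    reach K S k w u ≡ true
  reach-sym zero    Su Sw r rewrite ==-sound r = ==-refl _
  reach-sym (suc k) {u} {w} Su Sw r with reach-unsnoc k r
  ... | inj₁ short = ∨-introˡ (reach-sym k Su Sw short)
  ... | inj₂ (x , r′ , Sx , xw) = reach-weaken (≤-reflexive (+-comm k 1))
    (reach-++ 1 k (reach-snoc 0 (==-refl w) Sw (trans (Graph.sym K w x) xw)) Sx (reach-sym k Su Sx r′))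

  Stable : ℕ → Fin n → Set
  Stable k u = ∀ w → reach K S (suc k) u w ≡ true → reach K S k u w ≡ true

  stable-forever : ∀ {k u} → Stable k u → ∀ d {w} → reach K S (d + k) u w ≡ true → reach K S k u w ≡ true
  stable-forever st zero    r = r
  stable-forever {k} st (suc d) r with reach-unsnoc (d + k) r
  ... | inj₁ short              = stable-forever st d short
  ... | inj₂ (x , r′ , Sx , xw) = st _ (reach-snoc k (stable-forever st d r′) Sx xw)

  step-adds-nothing : ∀ k u w → Dec (reach K S k u w ≡ reach K S (suc k) u w)
  step-adds-nothing k u w = reach K S k u w ≟ᵇ reach K S (suc k) u w

  stable-or-large : ∀ u k → Σ ℕ (λ j → j ≤ k × Stable j u) ⊎ suc k ≤ count (reach K S k u)
  stable-or-large u zero = inj₂ (count-pos _ u (==-refl u))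
  stable-or-large u (suc k) with stable-or-large u k
  ... | inj₁ (j , j≤k , st) = inj₁ (j , m≤n⇒m≤1+n j≤k , st)
  ... | inj₂ large with all? (step-adds-nothing k u)
  ... | yes same = inj₁ (k , n≤1+n k , λ w r → trans (same w) r)
  ... | no differ with w , new ← ¬∀⟶∃¬ n _ (step-adds-nothing k u) differ
    = inj₂ (≤-trans (s≤s large) (count-strict _ _ (λ _ → ∨-introˡ) w (proj₂ fresh) (proj₁ fresh)))
    where
    fresh : reach K S k u w ≡ false × reach K S (suc k) u w ≡ true
    fresh = newly-true ∨-introˡ new

  reach-saturate : ∀ m {u w} → reach K S m u w ≡ true → reach K S n u w ≡ true
  reach-saturate m {u} r with stable-or-large u n
  ... | inj₂ large          = contradiction (count-≤ (reach K S n u)) (<⇒≱ large)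
  ... | inj₁ (j , j≤n , st) = reach-weaken j≤n (stable-forever st m (reach-weaken (m≤m+n m j) r))

module Components {n : ℕ} (K : Graph n) (S : Subset n) where
  open Walks K S

  sameComp-intro : ∀ k {u w} → lookup S u ≡ false → lookup S w ≡ false → reach K S k u w ≡ true →
    sameComp K S u w ≡ true
  sameComp-intro k Su Sw r rewrite Su | Sw = reach-saturate k r

  sameComp-outˡ : ∀ {u w} → sameComp K S u w ≡ true → lookup S u ≡ false
  sameComp-outˡ e = not-elim (∧-elimˡ e)

  sameComp-outʳ : ∀ {u w} → sameComp K S u w ≡ true → lookup S w ≡ false
  sameComp-outʳ {u} e = not-elim (∧-elimˡ (∧-elimʳ (not (lookup S u)) e))

  sameComp-reach : ∀ {u w} → sameComp K S u w ≡ true → reach K S n u w ≡ true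
  sameComp-reach {u} {w} e = ∧-elimʳ (not (lookup S w)) (∧-elimʳ (not (lookup S u)) e)

  sameComp-refl : ∀ {v} → lookup S v ≡ false → sameComp K S v v ≡ true
  sameComp-refl {v} Sv = sameComp-intro 0 Sv Sv (==-refl v)

  sameComp-sym : ∀ {u w} → sameComp K S u w ≡ true → sameComp K S w u ≡ true
  sameComp-sym e = sameComp-intro n (sameComp-outʳ e) (sameComp-outˡ e)
    (reach-sym n (sameComp-outˡ e) (sameComp-outʳ e) (sameComp-reach e))

  sameComp-trans : ∀ {u v w} → sameComp K S u v ≡ true → sameComp K S v w ≡ true → sameComp K S u w ≡ true
  sameComp-trans e e′ = sameComp-intro (n + n) (sameComp-outˡ e) (sameComp-outʳ e′)
    (reach-++ n n (sameComp-reach e) (sameComp-outʳ e) (sameComp-reach e′))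

  sameComp-edge : ∀ {u x y} → sameComp K S u x ≡ true → lookup S y ≡ false → adj K x y ≡ true →
    sameComp K S u y ≡ true
  sameComp-edge e Sy xy = sameComp-intro (suc n) (sameComp-outˡ e) Sy
    (reach-snoc n (sameComp-reach e) (sameComp-outʳ e) xy)

  sameComp-class : ∀ {x h} → sameComp K S x h ≡ true → ∀ y → sameComp K S h y ≡ sameComp K S x y
  sameComp-class xh y = bool-ext (sameComp-trans xh) (sameComp-trans (sameComp-sym xh))

  earlierInComp : Fin n → Fin n → Bool
  earlierInComp v u = (toℕ u <ᵇ toℕ v) ∧ sameComp K S u v

  isRep-least : ∀ {a b} → isRep K S b ≡ true → toℕ a < toℕ b → sameComp K S a b ≡ true → ⊥
  isRep-least {a} {b} rep-b a<b e = contradiction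
    (subst₂ (λ p q → not (p ∧ q) ≡ true) (Equivalence.to T-≡ (<⇒<ᵇ a<b)) e
      (all-elim (λ u → not (earlierInComp b u)) (∧-elimʳ (not (lookup S b)) rep-b) (∈-allFin a)))
    λ ()

  isRep-unique : ∀ {a b} → isRep K S a ≡ true → isRep K S b ≡ true → sameComp K S a b ≡ true → a ≡ b
  isRep-unique {a} {b} rep-a rep-b e with <-cmp (toℕ a) (toℕ b)
  ... | tri< a<b _ _ = ⊥-elim (isRep-least rep-b a<b e)
  ... | tri≈ _ a≡b _ = toℕ-injective a≡b
  ... | tri> _ _ b<a = ⊥-elim (isRep-least rep-a b<a (sameComp-sym e))

  nonRep-earlier : ∀ {x} → lookup S x ≡ false → isRep K S x ≡ false →
    Σ (Fin n) (λ u → toℕ u < toℕ x × sameComp K S u x ≡ true)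
  -- (isRep K S x unfolds to `not (lookup S x) ∧ all (not ∘ earlierInComp x) (allFin n)`)
  nonRep-earlier {x} Sx not-rep
    with u , earlier ← all-counterexample _ (allFin n)
           (subst (λ t → t ∧ all (λ u → not (earlierInComp x u)) (allFin n) ≡ false) (not-intro Sx) not-rep)
    = u , <ᵇ⇒< _ _ (Equivalence.from T-≡ (∧-elimˡ u-earlier)) , ∧-elimʳ (toℕ u <ᵇ toℕ x) u-earlier
    where
    u-earlier : earlierInComp x u ≡ true
    u-earlier = not-injective earlier

  isRep-exists′ : ∀ k x → toℕ x < k → lookup S x ≡ false →
    Σ (Fin n) (λ h → isRep K S h ≡ true × sameComp K S x h ≡ true)
  isRep-exists′ (suc k) x x<k Sx with isRep K S x in rep-x
  ... | true = x , rep-x , sameComp-refl Sx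
  ... | false
    with u , u<x , ux ← nonRep-earlier Sx rep-x
    with h , rep-h , uh ← isRep-exists′ k u (<-≤-trans u<x (≤-pred x<k)) (sameComp-outˡ ux)
    = h , rep-h , sameComp-trans (sameComp-sym ux) uh

  isRep-exists : ∀ x → lookup S x ≡ false → Σ (Fin n) (λ h → isRep K S h ≡ true × sameComp K S x h ≡ true)
  isRep-exists x = isRep-exists′ n x (toℕ<n x)

-- Adding edges preserves walks, so it can only merge components of K − S.
reach-mono : ∀ {n} {H G : Graph n} → H ⊆ᴳ G → (S : Subset n) → ∀ k {u w} →
  reach H S k u w ≡ true → reach G S k u w ≡ true
reach-mono H⊆G S zero    r = r
reach-mono {H = H} {G} H⊆G S (suc k) r with Walks.reach-unsnoc H S k r
... | inj₁ short              = ∨-introˡ (reach-mono H⊆G S k short)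
... | inj₂ (x , r′ , Sx , xw) = Walks.reach-snoc G S k (reach-mono H⊆G S k r′) Sx (H⊆G x _ xw)

sameComp-mono : ∀ {n} {H G : Graph n} → H ⊆ᴳ G → (S : Subset n) → ∀ {u w} →
  sameComp H S u w ≡ true → sameComp G S u w ≡ true
sameComp-mono {n} {H} {G} H⊆G S e =
  Components.sameComp-intro G S n (sameComp-outˡ e) (sameComp-outʳ e) (reach-mono H⊆G S n (sameComp-reach e))
  where open Components H S

oddRep : ∀ {n} → Graph n → Subset n → Fin n → Bool
oddRep K S v = isRep K S v ∧ isOdd (compSize K S v)

odd≡count : ∀ {n} (K : Graph n) (S : Subset n) → odd K S ≡ count (oddRep K S)
odd≡count K S = countV≡count (oddRep K S)

oddRep-odd : ∀ {n} (K : Graph n) (S : Subset n) {r} → oddRep K S r ≡ true →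
  isOdd (count (sameComp K S r)) ≡ true
oddRep-odd K S {r} odd-r =
  subst (λ m → isOdd m ≡ true) (countV≡count (sameComp K S r)) (∧-elimʳ (isRep K S r) odd-r)

-- A fixed-point-free involution s splits the vertices into pairs {x, s x}; a set of odd
-- size is not a union of pairs, so it contains some x whose partner lies outside it.
module Involution {n : ℕ} (s : Fin n → Fin n)
  (s-invol : ∀ x → s (s x) ≡ x) (s-nofix : ∀ x → s x ≢ x) where

  pair : Fin n → Fin n → Bool
  pair x y = (y == x) ∨ (y == s x)

  pair-elim : ∀ x y → pair x y ≡ true → y ≡ x ⊎ y ≡ s x
  pair-elim x y e with ∨-elim (y == x) e
  ... | inj₁ y≡x  = inj₁ (==-sound y≡x)
  ... | inj₂ y≡sx = inj₂ (==-sound y≡sx)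

  pair-self : ∀ x → pair x x ≡ true
  pair-self x = ∨-introˡ (==-refl x)

  pair-partner : ∀ x → pair x (s x) ≡ true
  pair-partner x = ∨-introʳ (s x == x) (==-refl (s x))

  pair-sym : ∀ x y → pair x y ≡ true → pair y x ≡ true
  pair-sym x y e with pair-elim x y e
  ... | inj₁ refl = pair-self x
  ... | inj₂ refl = subst (λ z → pair (s x) z ≡ true) (s-invol x) (pair-partner (s x))

  pair-trans : ∀ x y z → pair x y ≡ true → pair y z ≡ true → pair x z ≡ true
  pair-trans x y z e e′ with pair-elim x y e | pair-elim y z e′
  ... | inj₁ refl | inj₁ refl = pair-self x
  ... | inj₁ refl | inj₂ refl = pair-partner x
  ... | inj₂ refl | inj₁ refl = pair-partner x
  ... | inj₂ refl | inj₂ refl = subst (λ z → pair x z ≡ true) (sym (s-invol x)) (pair-self x)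

  -- x ≠ s x, so each pair has two elements
  pair-count : ∀ x → count (pair x) ≡ 2
  pair-count x = begin
    count (pair x)
      ≡⟨ count-split (pair x) (_== x) ⟩
    count (λ y → pair x y ∧ (y == x)) + count (λ y → pair x y ∧ not (y == x))
      ≡⟨ cong₂ _+_ (count-cong first) (count-cong second) ⟩
    count (_== x) + count (_== s x)
      ≡⟨ cong₂ _+_ (count-single x) (count-single (s x)) ⟩
    2 ∎
    where
    open ≡-Reasoning
    first : ∀ y → pair x y ∧ (y == x) ≡ (y == x)
    first y with y == x | y == s x
    ... | true  | _     = refl
    ... | false | true  = refl
    ... | false | false = refl
    second : ∀ y → pair x y ∧ not (y == x) ≡ (y == s x)
    second y with y == x in y≡x | y == s x in y≡sx
    ... | true  | true  = ⊥-elim (s-nofix x (trans (sym (==-sound y≡sx)) (==-sound y≡x)))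
    ... | true  | false = refl
    ... | false | true  = refl
    ... | false | false = refl

  open OddClass pair pair-sym pair-trans

  odd-escapes : ∀ C → isOdd (count C) ≡ true → Σ (Fin n) (λ x → C x ≡ true × C (s x) ≡ false)
  odd-escapes C odd-C with x , Cx , odd-x ← oddClass C (λ x _ → pair-self x) odd-C with C (s x) in Csx
  ... | false = x , Cx , Csx
  ... | true  = ⊥-elim (true≢false odd-x (cong isOdd (trans (count-cong whole-pair) (pair-count x))))
    where
    -- both x and s x lie in C, so C contains the whole pair
    whole-pair : ∀ y → classIn C x y ≡ pair x y
    whole-pair y = bool-ext (∧-elimʳ (C y)) (λ p → ∧-intro (in-C (pair-elim x y p)) p)
      where
      in-C : y ≡ x ⊎ y ≡ s x → C y ≡ true
      in-C (inj₁ refl) = Cx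
      in-C (inj₂ refl) = Csx

module PerfectMatching {n : ℕ} (K : Graph n) (σ : Vec (Fin n) n) (pm : isPM K σ ≡ true) where

  partner : Fin n → Fin n
  partner v = lookup σ v

  matched : ∀ v → ((partner (partner v) == v) ∧ not (partner v == v) ∧ adj K v (partner v)) ≡ true
  matched v = all-elim _ pm (∈-allFin v)

  partner-invol : ∀ v → partner (partner v) ≡ v
  partner-invol v = ==-sound (∧-elimˡ (matched v))

  partner-nofix : ∀ v → partner v ≢ v
  partner-nofix v eq = true≢false
    (subst (λ z → (partner v == z) ≡ true) eq (==-refl (partner v)))
    (not-elim (∧-elimˡ (∧-elimʳ (partner (partner v) == v) (matched v))))

  partner-edge : ∀ v → adj K v (partner v) ≡ true
  partner-edge v = ∧-elimʳ (not (partner v == v)) (∧-elimʳ (partner (partner v) == v) (matched v))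

-- An odd component contains a vertex x matched outside it, hence into S; sending the
-- component to the partner of x is injective because the matching is.
tutte-easy : ∀ {n} (K : Graph n) (S : Subset n) (σ : Vec (Fin n) n) → isPM K σ ≡ true → odd K S ≤ ∣ S ∣
tutte-easy {n} K S σ pm = subst₂ _≤_ (sym (odd≡count K S)) (sym (∣∣≡count S))
  (count-injection (oddRep K S) (lookup S) matchedInto image unique)
  where
  open PerfectMatching K σ pm
  open Components K S
  open Involution partner partner-invol partner-nofix

  matchedInto : Fin n → Fin n → Set
  matchedInto r w = Σ (Fin n) (λ x → sameComp K S r x ≡ true × partner x ≡ w)

  image : ∀ r → oddRep K S r ≡ true → Σ (Fin n) (λ w → lookup S w ≡ true × matchedInto r w)
  image r odd-r with x , rx , escapes ← odd-escapes (sameComp K S r) (oddRep-odd K S odd-r)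
    = partner x , ¬-not (λ S-out → true≢false (sameComp-edge rx S-out (partner-edge x)) escapes) , x , rx , refl

  unique : ∀ r r′ w → oddRep K S r ≡ true → oddRep K S r′ ≡ true →
    matchedInto r w → matchedInto r′ w → r ≡ r′
  unique r r′ w odd-r odd-r′ (x , rx , refl) (x′ , r′x′ , px′≡px)
    with refl ← trans (sym (partner-invol x′)) (trans (cong partner px′≡px) (partner-invol x))
    = isRep-unique (∧-elimˡ odd-r) (∧-elimˡ odd-r′) (sameComp-trans rx (sameComp-sym r′x′))

-- For a spanning subgraph H ⊆ G, odd(G − S) ≤ odd(H − S): an odd component of G − S is a
-- union of components of H − S, one of which is odd; sending it to the representative of
-- that component is injective since it stays inside the component of G − S.
odd-antitone : ∀ {n} {H G : Graph n} → H ⊆ᴳ G → (S : Subset n) → odd G S ≤ odd H S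
odd-antitone {n} {H} {G} H⊆G S = subst₂ _≤_ (sym (odd≡count G S)) (sym (odd≡count H S))
  (count-injection (oddRep G S) (oddRep H S) (λ r h → sameComp G S r h ≡ true) image unique)
  where
  module G = Components G S
  module H = Components H S
  open OddClass (sameComp H S) (λ _ _ → H.sameComp-sym) (λ _ _ _ → H.sameComp-trans)

  image : ∀ r → oddRep G S r ≡ true → Σ (Fin n) (λ h → oddRep H S h ≡ true × sameComp G S r h ≡ true)
  image r odd-r
    with x , rx , odd-x ← oddClass (sameComp G S r) (λ _ rx → H.sameComp-refl (G.sameComp-outʳ rx))
                                   (oddRep-odd G S odd-r)
    with h , rep-h , xh ← H.isRep-exists x (G.sameComp-outʳ rx)
    = h , ∧-intro rep-h odd-h , G.sameComp-trans rx (sameComp-mono H⊆G S xh)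
    where
    inside : ∀ y → classIn (sameComp G S r) x y ≡ sameComp H S x y
    inside y = bool-ext (∧-elimʳ (sameComp G S r y))
      (λ xy → ∧-intro (G.sameComp-trans rx (sameComp-mono H⊆G S xy)) xy)
    odd-h : isOdd (compSize H S h) ≡ true
    odd-h = begin
      isOdd (compSize H S h)                        ≡⟨ cong isOdd (countV≡count (sameComp H S h)) ⟩
      isOdd (count (sameComp H S h))                ≡⟨ cong isOdd (count-cong (H.sameComp-class xh)) ⟩
      isOdd (count (sameComp H S x))                ≡⟨ cong isOdd (count-cong (λ y → sym (inside y))) ⟩
      isOdd (count (classIn (sameComp G S r) x))    ≡⟨ odd-x ⟩
      true                                          ∎
      where open ≡-Reasoning

  unique : ∀ r r′ h → oddRep G S r ≡ true → oddRep G S r′ ≡ true →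
    sameComp G S r h ≡ true → sameComp G S r′ h ≡ true → r ≡ r′
  unique r r′ h odd-r odd-r′ rh r′h =
    G.isRep-unique (∧-elimˡ odd-r) (∧-elimˡ odd-r′) (G.sameComp-trans rh (G.sameComp-sym r′h))

-- A 1-extendable graph on at least two vertices has a perfect matching: vertex 1 is
-- reachable from vertex 0, so it has a neighbour, and that edge is extendable.
oneExtendable-perfectMatching : ∀ {m} (H : Graph (suc (suc m))) → OneExtendable H →
  Σ (Vec (Fin (suc (suc m))) (suc (suc m))) (λ σ → isPM H σ ≡ true)
oneExtendable-perfectMatching {m} H (connected , extendable)
  with x , x1 ← Walks.reach-last-edge H ∅ (suc (suc m)) {zero} (connected zero (suc zero)) (λ ())
  with σ , pm , _ ← extendable x (suc zero) x1
  = σ , pm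

-- A graph on one vertex has no barrier: ∅ leaves one odd component, the whole set none.
noBarrier-singleVertex : (G : Graph 1) (S : Subset 1) → ¬ Barrier G S
noBarrier-singleVertex G (true ∷ [])  ()
noBarrier-singleVertex G (false ∷ []) ()

-- Lemma 5.4. On no vertices every set is a barrier; on one vertex G has no barrier;
-- otherwise |S| = odd(G − S) ≤ odd(H − S) ≤ |S|, using a perfect matching of H.
lemma5p4 : {n : ℕ} (H G : Graph n) → OneExtendable H → H ⊆ᴳ G → Φ G ≡ Φ H →
    (S : Subset n) → Barrier G S → Barrier H S
lemma5p4 {zero}        H G _      _   _ [] _       = refl
lemma5p4 {suc zero}    H G _      _   _ S barrier = ⊥-elim (noBarrier-singleVertex G S barrier)
lemma5p4 {suc (suc m)} H G oneExt H⊆G _ S barrier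
  with σ , pm ← oneExtendable-perfectMatching H oneExt
  = ≤-antisym (tutte-easy H S σ pm) (begin
      ∣ S ∣     ≡⟨ sym barrier ⟩
      odd G S   ≤⟨ odd-antitone H⊆G S ⟩
      odd H S   ∎)
  where open ≤-Reasoning
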